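{- Let $G$ be a finite group and let $n$ be a positive integer relatively prime to $|G|$. Then $\mathcal{P}_e(G\times\mathbb{Z}_n)$ is a cograph if and only if $\mathcal{P}_e(G)$ is a cograph, and $\mathcal{P}_e(G\times\mathbb{Z}_n)$ is a chordal graph if and only if $\mathcal{P}_e(G)$ is a chordal graph.
   Context: For a finite group $G$, the enhanced power graph $\mathcal{P}_e(G)$ is the simple graph with vertex set $G$ in which two distinct vertices $x,y$ are adjacent if and only if $\langle x,y\rangle$ is cyclic. A graph is chordal if it has no induced cycle of length greater than $3$; it is a cograph if it has no induced subgraph isomorphic to the path $P_4$ on four vertices. $\mathbb{Z}_n$ is the cyclic group of order $n$. -}

module Defs where

open import Level using (0ℓ)
open import Data.Nat using (ℕ; _∸_; _≤_; _+_; NonZero)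
open import Data.Nat.DivMod using (_%_; m%n<n)
open import Data.Fin using (Fin; toℕ; fromℕ<; zero; suc)
open import Data.Sum using (_⊎_)
open import Data.Product using (Σ; _×_; _,_; ∃)
open import Relation.Binary.PropositionalEquality using (_≡_)
open import Relation.Nullary using (¬_)
open import Algebra.Structures using (IsGroup)
open import Function.Definitions using (Injective)

record GroupOps : Set₁ where
  field
    Carrier : Set
    _∙_     : Carrier → Carrier → Carrier
    ε       : Carrier
    _⁻¹     : Carrier → Carrier

-- A finite group of order |G| = order, realised on the carrier Fin order
-- (every finite group is isomorphic to one of this form).
record FiniteGroup : Set₁ where
  field
    order   : ℕ
    _∙_     : Fin order → Fin order → Fin order
    ε       : Fin order
    _⁻¹     : Fin order → Fin order
    isGroup : IsGroup (_≡_ {A = Fin order}) _∙_ ε _⁻¹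

  ops : GroupOps
  ops = record { Carrier = Fin order ; _∙_ = _∙_ ; ε = ε ; _⁻¹ = _⁻¹ }

module _ (G : GroupOps) where
  open GroupOps G

  data Gen (S : Carrier → Set) : Carrier → Set where
    gen : ∀ {g} → S g → Gen S g
    one : Gen S ε
    mul : ∀ {g h} → Gen S g → Gen S h → Gen S (g ∙ h)
    inv : ∀ {g} → Gen S g → Gen S (g ⁻¹)

  Pair : Carrier → Carrier → Carrier → Set
  Pair x y g = (g ≡ x) ⊎ (g ≡ y)

  CyclicGen : (Carrier → Set) → Set
  CyclicGen S = Σ Carrier λ z → Gen S z × (∀ w → Gen S w → Gen (_≡ z) w)

  EPAdj : Carrier → Carrier → Set
  EPAdj x y = ¬ (x ≡ y) × CyclicGen (Pair x y)

record Graph : Set₁ where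
  field
    V   : Set
    Adj : V → V → Set

EnhancedPowerGraph : GroupOps → Graph
EnhancedPowerGraph G = record { V = GroupOps.Carrier G ; Adj = EPAdj G }

v0 v1 v2 v3 : Fin 4
v0 = zero
v1 = suc zero
v2 = suc (suc zero)
v3 = suc (suc (suc zero))

module _ (Γ : Graph) where
  open Graph Γ

  InducedP4 : Set
  InducedP4 = Σ (Fin 4 → V) λ f → Injective _≡_ _≡_ f ×
    (Adj (f v0) (f v1) × Adj (f v1) (f v2) × Adj (f v2) (f v3) ×
     ¬ Adj (f v0) (f v2) × ¬ Adj (f v0) (f v3) × ¬ Adj (f v1) (f v3))

  IsCograph : Set
  IsCograph = ¬ InducedP4

  CycNext : {m : ℕ} → Fin m → Fin m → Set
  CycNext {m} i j = (1 + toℕ i ≡ toℕ j) ⊎ (1 + toℕ i ≡ m × toℕ j ≡ 0)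

  CycAdj : {m : ℕ} → Fin m → Fin m → Set
  CycAdj i j = CycNext i j ⊎ CycNext j i

  InducedCycle : ℕ → Set
  InducedCycle m = Σ (Fin m → V) λ f → Injective _≡_ _≡_ f ×
    (∀ i j → (Adj (f i) (f j) → CycAdj i j) × (CycAdj i j → Adj (f i) (f j)))

  IsChordal : Set
  IsChordal = ∀ m → 4 ≤ m → ¬ InducedCycle m

ℤ[_] : (n : ℕ) → .{{NonZero n}} → GroupOps
ℤ[ n ] = record
  { Carrier = Fin n
  ; _∙_ = λ i j → fromℕ< (m%n<n (toℕ i + toℕ j) n)
  ; ε   = fromℕ< (m%n<n 0 n)
  ; _⁻¹ = λ i → fromℕ< (m%n<n (n ∸ toℕ i) n)
  }

_×G_ : GroupOps → GroupOps → GroupOps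
G ×G H = record
  { Carrier = G.Carrier × H.Carrier
  ; _∙_ = λ { (a , b) (c , d) → (a G.∙ c) , (b H.∙ d) }
  ; ε   = G.ε , H.ε
  ; _⁻¹ = λ { (a , b) → (a G.⁻¹) , (b H.⁻¹) }
  }
  where
    module G = GroupOps G
    module H = GroupOps H

-- If p * n ≡ 1 (mod |G|), then by Lagrange (g , t) ^ (p * n) ≡ (g , 0).  So a subgroup of
-- G × ℤₙ containing (g , t) contains (g , 0) and (ε , t), and as two elements of ℤₙ generate
-- the cyclic subgroup generated by their gcd, ⟨(x , a) , (y , b)⟩ is cyclic iff ⟨x , y⟩ is.
-- Hence 𝒫ₑ(G × ℤₙ) is 𝒫ₑ(G) with every vertex blown up into a clique of closed twins.  An
-- induced P₄ or an induced cycle of length ≥ 4 contains no closed twins, so it projects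
-- injectively onto an induced copy in 𝒫ₑ(G); conversely g ↦ (g , 0) embeds 𝒫ₑ(G) as an
-- induced subgraph.

module Submission where

open import Defs
open import Level using (0ℓ)
open import Algebra.Bundles using (Group)
import Algebra.Properties.Group as GroupProperties
open import Algebra.Structures using (IsGroup)
open import Data.Empty using (⊥-elim)
open import Data.Fin using (Fin; zero; suc; toℕ; fromℕ; inject₁)
open import Data.Fin.Properties
  using (toℕ-injective; toℕ<n; toℕ-fromℕ; toℕ-fromℕ<; toℕ-inject₁; suc-injective; <-cmp; any?;
         pigeonhole; cantor-schröder-bernstein)
  renaming (_≟_ to _≟ᶠ_)
open import Data.Fin.Subset using (Subset; _∈_; ∣_∣; _∩_; ∁; ⊤; inside; outside)
open import Data.Fin.Subset.Properties
  using (x∈p∩q⁺; x∈p∩q⁻; x∈∁p⇒x∉p; x∉p⇒x∈∁p; ∈⊤; ∣⊤∣≡n; ∣⊥∣≡0; Empty-unique; nonempty?)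
open import Data.Nat
  using (ℕ; zero; suc; _+_; _*_; _∸_; _≤_; _<_; s≤s; z≤n; pred; NonZero; >-nonZero⁻¹)
open import Data.Nat.Coprimality using (Coprime; coprime-Bézout)
open import Data.Nat.DivMod
  using (_%_; _mod_; m%n<n; %-distribˡ-+; [m+kn]%n≡m%n; m<n⇒m%n≡m; m*n%n≡0; n%n≡0)
open import Data.Nat.Divisibility using (_∣_; divides; ∣m∣n⇒∣m+n; ∣-refl; _∣0)
open import Data.Nat.GCD using (module Bézout; module GCD)
open import Data.Nat.Induction using (<-wellFounded)
open import Data.Nat.Properties
  using (+-suc; +-assoc; *-distribˡ-+; *-zeroʳ; +-cancelˡ-≡; *-identityˡ; *-identityʳ; m<n+m;
         <-≤-trans; ≤-refl; ≤-trans; n≤1+n; m∸n≤m; ∸-monoˡ-<; +-∸-assoc; <⇒≤; m+[n∸m]≡n; m≢1+n+m; 1+n≢n)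
open import Data.Nat.Tactic.RingSolver using (solve-∀)
open import Data.Product using (∃; ∃₂; _×_; _,_; proj₁; proj₂)
open import Data.Sum using (_⊎_; inj₁; inj₂)
open import Data.Vec using (_∷_; []; here; there; tabulate)
open import Function using (_∘_)
open import Function.Bundles using (_⇔_; mk⇔; Equivalence)
open import Function.Definitions using (Injective)
open import Induction.WellFounded using (Acc; acc)
open import Relation.Binary.Definitions using (tri<; tri≈; tri>)
open import Relation.Binary.PropositionalEquality
  using (_≡_; refl; sym; trans; cong; cong₂; subst; subst₂; module ≡-Reasoning)
open import Relation.Nullary using (¬_; yes; no; does; contradiction)
open import Relation.Unary using (Pred; Decidable)

open Equivalence using (to; from)

enumerate : ∀ {m} (p : Subset m) → Fin ∣ p ∣ → Fin m
enumerate (inside  ∷ p) zero    = zero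
enumerate (inside  ∷ p) (suc i) = suc (enumerate p i)
enumerate (outside ∷ p) i       = suc (enumerate p i)

enumerate-∈ : ∀ {m} (p : Subset m) i → enumerate p i ∈ p
enumerate-∈ (inside  ∷ p) zero    = here
enumerate-∈ (inside  ∷ p) (suc i) = there (enumerate-∈ p i)
enumerate-∈ (outside ∷ p) i       = there (enumerate-∈ p i)

enumerate-injective : ∀ {m} (p : Subset m) → Injective _≡_ _≡_ (enumerate p)
enumerate-injective (inside  ∷ p) {zero}  {zero}  _ = refl
enumerate-injective (inside  ∷ p) {suc i} {suc j} e =
  cong suc (enumerate-injective p (suc-injective e))
enumerate-injective (outside ∷ p) e = enumerate-injective p (suc-injective e)

position : ∀ {m} {p : Subset m} {x} → x ∈ p → Fin ∣ p ∣
position                 here        = zero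
position {p = inside  ∷ p} (there x∈p) = suc (position x∈p)
position {p = outside ∷ p} (there x∈p) = position x∈p

enumerate-position : ∀ {m} {p : Subset m} {x} (x∈p : x ∈ p) → enumerate p (position x∈p) ≡ x
enumerate-position                 here        = refl
enumerate-position {p = inside  ∷ p} (there x∈p) = cong suc (enumerate-position x∈p)
enumerate-position {p = outside ∷ p} (there x∈p) = cong suc (enumerate-position x∈p)

injective-onto⇒∣p∣≡ : ∀ {d m} {p : Subset m} (f : Fin d → Fin m) → Injective _≡_ _≡_ f →
           (∀ k → f k ∈ p) → (∀ {y} → y ∈ p → ∃ λ k → f k ≡ y) → ∣ p ∣ ≡ d
injective-onto⇒∣p∣≡ {p = p} f f-injective f∈p onto =
  cantor-schröder-bernstein {f = preimage} {g = position ∘ f∈p}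
    preimage-injective position∘f-injective
  where
  preimage : Fin ∣ p ∣ → Fin _
  preimage i = proj₁ (onto (enumerate-∈ p i))

  preimage-injective : Injective _≡_ _≡_ preimage
  preimage-injective {i} {j} e = enumerate-injective p (begin
    enumerate p i        ≡⟨ proj₂ (onto (enumerate-∈ p i)) ⟨
    f (preimage i)       ≡⟨ cong f e ⟩
    f (preimage j)       ≡⟨ proj₂ (onto (enumerate-∈ p j)) ⟩
    enumerate p j        ∎)
    where open ≡-Reasoning

  position∘f-injective : Injective _≡_ _≡_ (position ∘ f∈p)
  position∘f-injective {k} {l} e = f-injective (begin
    f k                              ≡⟨ enumerate-position (f∈p k) ⟨
    enumerate p (position (f∈p k))   ≡⟨ cong (enumerate p) e ⟩
    enumerate p (position (f∈p l))   ≡⟨ enumerate-position (f∈p l) ⟩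
    f l                              ∎)
    where open ≡-Reasoning

∣p∣≡∣p∩q∣+∣p∩∁q∣ : ∀ {m} (p q : Subset m) → ∣ p ∣ ≡ ∣ p ∩ q ∣ + ∣ p ∩ ∁ q ∣
∣p∣≡∣p∩q∣+∣p∩∁q∣ []            []            = refl
∣p∣≡∣p∩q∣+∣p∩∁q∣ (inside  ∷ p) (inside  ∷ q) = cong suc (∣p∣≡∣p∩q∣+∣p∩∁q∣ p q)
∣p∣≡∣p∩q∣+∣p∩∁q∣ (inside  ∷ p) (outside ∷ q) =
  trans (cong suc (∣p∣≡∣p∩q∣+∣p∩∁q∣ p q)) (sym (+-suc _ _))
∣p∣≡∣p∩q∣+∣p∩∁q∣ (outside ∷ p) (_       ∷ q) = ∣p∣≡∣p∩q∣+∣p∩∁q∣ p q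

subset : ∀ {m} {P : Pred (Fin m) 0ℓ} → Decidable P → Subset m
subset P? = tabulate (does ∘ P?)

∈-subset⁺ : ∀ {m} {P : Pred (Fin m) 0ℓ} (P? : Decidable P) {x} → P x → x ∈ subset P?
∈-subset⁺ P? {zero} px with P? zero
... | yes _  = here
... | no ¬px = contradiction px ¬px
∈-subset⁺ P? {suc x} px = there (∈-subset⁺ (P? ∘ suc) px)

∈-subset⁻ : ∀ {m} {P : Pred (Fin m) 0ℓ} (P? : Decidable P) {x} → x ∈ subset P? → P x
∈-subset⁻ P? {zero} x∈ with P? zero | x∈
... | yes px | _ = px
∈-subset⁻ P? {suc x} (there x∈) = ∈-subset⁻ (P? ∘ suc) x∈

-- Lagrange: g ^ |G| ≡ ε

∃-least : (P : ℕ → Set) → Decidable P → ∀ {m} → P m →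
          ∃ λ d → P d × (∀ k → k < d → ¬ P k)
∃-least P P? {zero} p = zero , p , λ _ ()
∃-least P P? {suc m} p with P? zero
... | yes p0 = zero , p0 , λ _ ()
... | no ¬p0 with ∃-least (P ∘ suc) (P? ∘ suc) p
... | d , pd , below = suc d , pd , λ { zero _ → ¬p0 ; (suc k) (s≤s k<d) → below k k<d }

power : (G : GroupOps) → GroupOps.Carrier G → ℕ → GroupOps.Carrier G
power G g zero    = GroupOps.ε G
power G g (suc k) = GroupOps._∙_ G g (power G g k)

module FiniteGroupProperties (G : FiniteGroup) where
  open FiniteGroup G public
  open IsGroup isGroup public using (assoc; identityˡ; identityʳ; inverseˡ)

  group : Group 0ℓ 0ℓ
  group = record { isGroup = isGroup }

  open GroupProperties group public using (∙-cancelˡ; ∙-cancelʳ; ε⁻¹≈ε)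
  open ≡-Reasoning

  infixr 30 _^_
  _^_ : Fin order → ℕ → Fin order
  _^_ = power ops

  ^-+ : ∀ g i j → g ^ (i + j) ≡ g ^ i ∙ g ^ j
  ^-+ g zero    j = sym (identityˡ _)
  ^-+ g (suc i) j = trans (cong (g ∙_) (^-+ g i j)) (sym (assoc _ _ _))

  ^-*-ε : ∀ {g d} → g ^ d ≡ ε → ∀ q → g ^ (q * d) ≡ ε
  ^-*-ε         gᵈ≡ε zero    = refl
  ^-*-ε {g} {d} gᵈ≡ε (suc q) = begin
    g ^ (d + q * d)     ≡⟨ ^-+ g d (q * d) ⟩
    g ^ d ∙ g ^ (q * d) ≡⟨ cong₂ _∙_ gᵈ≡ε (^-*-ε gᵈ≡ε q) ⟩
    ε ∙ ε               ≡⟨ identityˡ ε ⟩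
    ε                   ∎

  ^-∸ : ∀ g {i j} → i ≤ j → g ^ i ≡ g ^ j → g ^ (j ∸ i) ≡ ε
  ^-∸ g {i} {j} i≤j e = ∙-cancelˡ (g ^ i) _ _ (begin
    g ^ i ∙ g ^ (j ∸ i) ≡⟨ ^-+ g i (j ∸ i) ⟨
    g ^ (i + (j ∸ i))   ≡⟨ cong (g ^_) (m+[n∸m]≡n i≤j) ⟩
    g ^ j               ≡⟨ e ⟨
    g ^ i               ≡⟨ identityʳ _ ⟨
    g ^ i ∙ ε           ∎)

  -- (1 + j) ∸ suc i reduces to j ∸ i, so +-∸-assoc 1 i<j : j ∸ i ≡ suc (j ∸ suc i)
  ^-period : ∀ g {i j} → i < j → g ^ i ≡ g ^ j → g ^ suc (j ∸ suc i) ≡ ε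
  ^-period g i<j e = subst (λ k → g ^ k ≡ ε) (+-∸-assoc 1 i<j) (^-∸ g (<⇒≤ i<j) e)

  ∃-period : ∀ g → ∃ λ e → g ^ suc e ≡ ε
  ∃-period g with pigeonhole ≤-refl (λ (k : Fin (suc order)) → g ^ toℕ k)
  ... | i , j , i<j , e = toℕ j ∸ suc (toℕ i) , ^-period g i<j e

  -- G splits into orbits of h ↦ z ∙ h, each of size d, the order of z
  module Orbits (z : Fin order) (d-1 : ℕ) (zᵈ≡ε : z ^ suc d-1 ≡ ε)
                (minimal : ∀ k → k < d-1 → ¬ z ^ suc k ≡ ε) where
    d : ℕ
    d = suc d-1

    no-repeat : ∀ {i j} → j < d → i < j → ¬ z ^ i ≡ z ^ j
    no-repeat {i} j<d i<j e =
      minimal _ (<-≤-trans (∸-monoˡ-< j<d i<j) (m∸n≤m d-1 i)) (^-period z i<j e)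

    ^-injective : ∀ (i j : Fin d) → z ^ toℕ i ≡ z ^ toℕ j → i ≡ j
    ^-injective i j e with <-cmp i j
    ... | tri< i<j _ _ = ⊥-elim (no-repeat (toℕ<n j) i<j e)
    ... | tri≈ _ i≡j _ = i≡j
    ... | tri> _ _ j<i = ⊥-elim (no-repeat (toℕ<n i) j<i (sym e))

    orbit-point : Fin order → Fin d → Fin order
    orbit-point g k = z ^ toℕ k ∙ g

    orbit : Fin order → Subset order
    orbit g = subset (λ h → any? (λ k → orbit-point g k ≟ᶠ h))

    ∈-orbit⁺ : ∀ {g h} k → orbit-point g k ≡ h → h ∈ orbit g
    ∈-orbit⁺ k e = ∈-subset⁺ (λ h → any? (λ k → orbit-point _ k ≟ᶠ h)) (k , e)

    ∈-orbit⁻ : ∀ {g h} → h ∈ orbit g → ∃ λ k → orbit-point g k ≡ h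
    ∈-orbit⁻ = ∈-subset⁻ (λ h → any? (λ k → orbit-point _ k ≟ᶠ h))

    Closed : Subset order → Set
    Closed S = ∀ {h} → h ∈ S → z ∙ h ∈ S

    orbit⊆ : ∀ {S g} → Closed S → g ∈ S → ∀ i → z ^ i ∙ g ∈ S
    orbit⊆ {S} {g} closed g∈S zero    = subst (_∈ S) (sym (identityˡ g)) g∈S
    orbit⊆ {S} {g} closed g∈S (suc i) =
      subst (_∈ S) (sym (assoc z (z ^ i) g)) (closed (orbit⊆ closed g∈S i))

    -- step back along the orbit, wrapping around at k = 0 via zᵈ ≡ ε
    orbit-predecessor : ∀ g h k → orbit-point g k ≡ z ∙ h → ∃ λ k′ → orbit-point g k′ ≡ h
    orbit-predecessor g h zero e = fromℕ d-1 , sym (∙-cancelˡ z _ _ (begin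
      z ∙ h                   ≡⟨ e ⟨
      ε ∙ g                   ≡⟨ cong (_∙ g) zᵈ≡ε ⟨
      (z ∙ z ^ d-1) ∙ g       ≡⟨ assoc z (z ^ d-1) g ⟩
      z ∙ (z ^ d-1 ∙ g)       ≡⟨ cong (λ t → z ∙ (z ^ t ∙ g)) (toℕ-fromℕ d-1) ⟨
      z ∙ orbit-point g (fromℕ d-1) ∎))
    orbit-predecessor g h (suc k) e = inject₁ k , sym (∙-cancelˡ z _ _ (begin
      z ∙ h                   ≡⟨ e ⟨
      (z ∙ z ^ toℕ k) ∙ g     ≡⟨ assoc z (z ^ toℕ k) g ⟩
      z ∙ (z ^ toℕ k ∙ g)     ≡⟨ cong (λ t → z ∙ (z ^ t ∙ g)) (toℕ-inject₁ k) ⟨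
      z ∙ orbit-point g (inject₁ k) ∎))

    ∣S∩orbit∣≡d : ∀ {S g} → Closed S → g ∈ S → ∣ S ∩ orbit g ∣ ≡ d
    ∣S∩orbit∣≡d {S} {g} closed g∈S = injective-onto⇒∣p∣≡ (orbit-point g)
      (λ e → ^-injective _ _ (∙-cancelʳ g _ _ e))
      (λ k → x∈p∩q⁺ (orbit⊆ closed g∈S (toℕ k) , ∈-orbit⁺ k refl))
      (λ y∈ → ∈-orbit⁻ (proj₂ (x∈p∩q⁻ S (orbit g) y∈)))

    S∩∁orbit-closed : ∀ {S g} → Closed S → Closed (S ∩ ∁ (orbit g))
    S∩∁orbit-closed {S} {g} closed h∈ with x∈p∩q⁻ S _ h∈
    ... | h∈S , h∉orbit = x∈p∩q⁺ (closed h∈S , x∉p⇒x∈∁p λ zh∈orbit →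
      let k , e = ∈-orbit⁻ zh∈orbit
          k′ , e′ = orbit-predecessor g _ k e
      in x∈∁p⇒x∉p h∉orbit (∈-orbit⁺ k′ e′))

    d∣∣S∣ : ∀ S → Closed S → Acc _<_ ∣ S ∣ → d ∣ ∣ S ∣
    d∣∣S∣ S closed (acc smaller) with nonempty? S
    ... | no empty = subst (d ∣_) (sym (trans (cong ∣_∣ (Empty-unique empty)) (∣⊥∣≡0 order))) (d ∣0)
    ... | yes (g , g∈S) = subst (d ∣_) (sym split) (∣m∣n⇒∣m+n ∣-refl rest)
      where
      split : ∣ S ∣ ≡ d + ∣ S ∩ ∁ (orbit g) ∣
      split = trans (∣p∣≡∣p∩q∣+∣p∩∁q∣ S (orbit g))
                    (cong (_+ ∣ S ∩ ∁ (orbit g) ∣) (∣S∩orbit∣≡d closed g∈S))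
      rest : d ∣ ∣ S ∩ ∁ (orbit g) ∣
      rest = d∣∣S∣ (S ∩ ∁ (orbit g)) (S∩∁orbit-closed closed)
        (smaller (subst (∣ S ∩ ∁ (orbit g) ∣ <_) (sym split) (m<n+m _ (s≤s z≤n))))

    d∣order : d ∣ order
    d∣order = subst (d ∣_) (∣⊤∣≡n order) (d∣∣S∣ ⊤ (λ _ → ∈⊤) (<-wellFounded _))

  ^-order≡ε : ∀ g → g ^ order ≡ ε
  ^-order≡ε g with ∃-period g
  ... | e , gᵉ⁺¹≡ε with ∃-least (λ k → g ^ suc k ≡ ε) (λ k → g ^ suc k ≟ᶠ ε) {e} gᵉ⁺¹≡ε
  ... | d-1 , gᵈ≡ε , minimal with Orbits.d∣order g d-1 gᵈ≡ε minimal
  ... | divides q order≡q*d = subst (λ k → g ^ k ≡ ε) (sym order≡q*d) (^-*-ε gᵈ≡ε q)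

record IsHomomorphism (A B : GroupOps) (f : GroupOps.Carrier A → GroupOps.Carrier B) : Set where
  private
    module A = GroupOps A
    module B = GroupOps B
  field
    ∙-homo  : ∀ x y → f (x A.∙ y) ≡ f x B.∙ f y
    ε-homo  : f A.ε ≡ B.ε
    ⁻¹-homo : ∀ x → f (x A.⁻¹) ≡ f x B.⁻¹

module _ {A B : GroupOps} {f : GroupOps.Carrier A → GroupOps.Carrier B}
         (f-homo : IsHomomorphism A B f) where
  open IsHomomorphism f-homo

  Gen-map : ∀ {S T} → (∀ {s} → S s → Gen B T (f s)) → ∀ {x} → Gen A S x → Gen B T (f x)
  Gen-map           S⊆ (gen s)   = S⊆ s
  Gen-map {T = T} S⊆ one       = subst (Gen B T) (sym ε-homo) one
  Gen-map {T = T} S⊆ (mul p q) = subst (Gen B T) (sym (∙-homo _ _)) (mul (Gen-map S⊆ p) (Gen-map S⊆ q))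
  Gen-map {T = T} S⊆ (inv p)   = subst (Gen B T) (sym (⁻¹-homo _)) (inv (Gen-map S⊆ p))

module _ {G : GroupOps} where
  open GroupOps G

  Gen-least : ∀ {S T} → (∀ {s} → S s → Gen G T s) → ∀ {x} → Gen G S x → Gen G T x
  Gen-least = Gen-map {A = G} {f = λ x → x}
    record { ∙-homo = λ _ _ → refl ; ε-homo = refl ; ⁻¹-homo = λ _ → refl }

  Pair⊆Gen : ∀ {T x y} → Gen G T x → Gen G T y → ∀ {s} → Pair G x y s → Gen G T s
  Pair⊆Gen x∈ y∈ (inj₁ refl) = x∈
  Pair⊆Gen x∈ y∈ (inj₂ refl) = y∈

  Gen-power : ∀ {S g} → Gen G S g → ∀ k → Gen G S (power G g k)
  Gen-power g∈ zero    = one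
  Gen-power g∈ (suc k) = mul g∈ (Gen-power g∈ k)

  cyclic : ∀ {S c} → Gen G S c → (∀ {s} → S s → Gen G (_≡ c) s) → CyclicGen G S
  cyclic {c = c} c∈ S⊆⟨c⟩ = c , c∈ , λ _ → Gen-least S⊆⟨c⟩

  Pair-cyclic-swap : ∀ {x y} → CyclicGen G (Pair G x y) → CyclicGen G (Pair G y x)
  Pair-cyclic-swap {x} {y} (c , c∈ , ⟨x,y⟩⊆⟨c⟩) =
    cyclic (Gen-least (Pair⊆Gen (gen (inj₂ refl)) (gen (inj₁ refl))) c∈)
           (Pair⊆Gen (⟨x,y⟩⊆⟨c⟩ y (gen (inj₂ refl))) (⟨x,y⟩⊆⟨c⟩ x (gen (inj₁ refl))))

  Pair-self-cyclic : ∀ x → CyclicGen G (Pair G x x)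
  Pair-self-cyclic x = cyclic (gen (inj₁ refl)) (Pair⊆Gen (gen refl) (gen refl))

module _ (A B : GroupOps) where
  private
    module A = GroupOps A
    module B = GroupOps B

  proj₁-homomorphism : IsHomomorphism (A ×G B) A proj₁
  proj₁-homomorphism = record { ∙-homo = λ _ _ → refl ; ε-homo = refl ; ⁻¹-homo = λ _ → refl }

  inj₁-homomorphism : B.ε B.∙ B.ε ≡ B.ε → B.ε B.⁻¹ ≡ B.ε → IsHomomorphism A (A ×G B) (_, B.ε)
  inj₁-homomorphism ε∙ε ε⁻¹ = record
    { ∙-homo = λ _ _ → cong (_ ,_) (sym ε∙ε) ; ε-homo = refl ; ⁻¹-homo = λ _ → cong (_ ,_) (sym ε⁻¹) }

  inj₂-homomorphism : A.ε A.∙ A.ε ≡ A.ε → A.ε A.⁻¹ ≡ A.ε → IsHomomorphism B (A ×G B) (A.ε ,_)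
  inj₂-homomorphism ε∙ε ε⁻¹ = record
    { ∙-homo = λ _ _ → cong (_, _) (sym ε∙ε) ; ε-homo = refl ; ⁻¹-homo = λ _ → cong (_, _) (sym ε⁻¹) }

  power-×G : ∀ a b k → power (A ×G B) (a , b) k ≡ (power A a k , power B b k)
  power-×G a b zero    = refl
  power-×G a b (suc k) = cong (GroupOps._∙_ (A ×G B) (a , b)) (power-×G a b k)

module ℤₙ (n : ℕ) .{{_ : NonZero n}} where
  open GroupOps ℤ[ n ] public
  open ≡-Reasoning

  infixr 30 _^_
  _^_ : Fin n → ℕ → Fin n
  _^_ = power ℤ[ n ]

  0%n≡0 : 0 % n ≡ 0
  0%n≡0 = m<n⇒m%n≡m (>-nonZero⁻¹ n)

  mod-cong : ∀ {m m′} → m % n ≡ m′ % n → m mod n ≡ m′ mod n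
  mod-cong {m} {m′} e = toℕ-injective (begin
    toℕ (m mod n)  ≡⟨ toℕ-fromℕ< (m%n<n m n) ⟩
    m % n          ≡⟨ e ⟩
    m′ % n         ≡⟨ toℕ-fromℕ< (m%n<n m′ n) ⟨
    toℕ (m′ mod n) ∎)

  toℕ-mod : ∀ t → toℕ t mod n ≡ t
  toℕ-mod t = toℕ-injective (trans (toℕ-fromℕ< (m%n<n (toℕ t) n)) (m<n⇒m%n≡m (toℕ<n t)))

  mod-∙ : ∀ m m′ → (m mod n) ∙ (m′ mod n) ≡ (m + m′) mod n
  mod-∙ m m′ = mod-cong (begin
    (toℕ (m mod n) + toℕ (m′ mod n)) % n
      ≡⟨ cong₂ (λ a b → (a + b) % n) (toℕ-fromℕ< (m%n<n m n)) (toℕ-fromℕ< (m%n<n m′ n)) ⟩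
    (m % n + m′ % n) % n                  ≡⟨ %-distribˡ-+ m m′ n ⟨
    (m + m′) % n                          ∎)

  mod-^ : ∀ m k → (m mod n) ^ k ≡ (k * m) mod n
  mod-^ m zero    = refl
  mod-^ m (suc k) = trans (cong ((m mod n) ∙_) (mod-^ m k)) (mod-∙ m (k * m))

  ^-toℕ : ∀ t k → t ^ k ≡ (k * toℕ t) mod n
  ^-toℕ t k = trans (cong (_^ k) (sym (toℕ-mod t))) (mod-^ (toℕ t) k)

  identityˡ : ∀ t → ε ∙ t ≡ t
  identityˡ t = begin
    ε ∙ t                        ≡⟨ cong (ε ∙_) (toℕ-mod t) ⟨
    (0 mod n) ∙ (toℕ t mod n)    ≡⟨ mod-∙ 0 (toℕ t) ⟩
    toℕ t mod n                  ≡⟨ toℕ-mod t ⟩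
    t                            ∎

  ε⁻¹≡ε : ε ⁻¹ ≡ ε
  ε⁻¹≡ε = mod-cong (begin
    (n ∸ toℕ (0 mod n)) % n  ≡⟨ cong (λ a → (n ∸ a) % n) (trans (toℕ-fromℕ< (m%n<n 0 n)) 0%n≡0) ⟩
    n % n                    ≡⟨ n%n≡0 n ⟩
    0                        ≡⟨ 0%n≡0 ⟨
    0 % n                    ∎)

  ^-*-modulus : ∀ t q → t ^ (q * n) ≡ ε
  ^-*-modulus t q = trans (^-toℕ t (q * n)) (mod-cong (begin
    (q * n * toℕ t) % n   ≡⟨ cong (_% n) (swap-factors q n (toℕ t)) ⟩
    (q * toℕ t * n) % n   ≡⟨ m*n%n≡0 (q * toℕ t) n ⟩
    0                     ≡⟨ 0%n≡0 ⟨
    0 % n                 ∎))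
    where
    swap-factors : ∀ q n t → q * n * t ≡ q * t * n
    swap-factors = solve-∀

  gcd-generates : ∀ {g} a b x y → g ∣ toℕ a → g ∣ toℕ b → g + y * toℕ b ≡ x * toℕ a →
                  CyclicGen ℤ[ n ] (Pair ℤ[ n ] a b)
  gcd-generates {g} a b x y g∣a g∣b bézout =
    cyclic gcd∈⟨a,b⟩ (Pair⊆Gen (∈⟨gcd⟩ a g∣a) (∈⟨gcd⟩ b g∣b))
    where
    A B : ℕ
    A = toℕ a
    B = toℕ b

    combination : x * A + y * (n ∸ B) ≡ g + y * n
    combination = begin
      x * A + y * (n ∸ B)       ≡⟨ cong (_+ y * (n ∸ B)) bézout ⟨
      g + y * B + y * (n ∸ B)   ≡⟨ +-assoc g (y * B) (y * (n ∸ B)) ⟩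
      g + (y * B + y * (n ∸ B)) ≡⟨ cong (g +_) (*-distribˡ-+ y B (n ∸ B)) ⟨
      g + y * (B + (n ∸ B))     ≡⟨ cong (λ m → g + y * m) (m+[n∸m]≡n (<⇒≤ (toℕ<n b))) ⟩
      g + y * n                 ∎

    gcd∈⟨a,b⟩ : Gen ℤ[ n ] (Pair ℤ[ n ] a b) (g mod n)
    gcd∈⟨a,b⟩ = subst (Gen ℤ[ n ] (Pair ℤ[ n ] a b)) (begin
      a ^ x ∙ (b ⁻¹) ^ y                       ≡⟨ cong₂ _∙_ (^-toℕ a x) (mod-^ (n ∸ B) y) ⟩
      ((x * A) mod n) ∙ ((y * (n ∸ B)) mod n)  ≡⟨ mod-∙ (x * A) (y * (n ∸ B)) ⟩
      (x * A + y * (n ∸ B)) mod n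
        ≡⟨ mod-cong (trans (cong (_% n) combination) ([m+kn]%n≡m%n g y n)) ⟩
      g mod n                                  ∎)
      (mul (Gen-power (gen (inj₁ refl)) x) (Gen-power (inv (gen (inj₂ refl))) y))

    ∈⟨gcd⟩ : ∀ t → g ∣ toℕ t → Gen ℤ[ n ] (_≡ g mod n) t
    ∈⟨gcd⟩ t (divides q t≡q*g) = subst (Gen ℤ[ n ] (_≡ g mod n))
      (trans (mod-^ g q) (trans (cong (_mod n) (sym t≡q*g)) (toℕ-mod t)))
      (Gen-power (gen refl) q)

  Pair-cyclic : ∀ a b → CyclicGen ℤ[ n ] (Pair ℤ[ n ] a b)
  Pair-cyclic a b with Bézout.lemma (toℕ a) (toℕ b)
  ... | Bézout.result g gcd (Bézout.+- x y eq) =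
    gcd-generates a b x y (GCD.gcd∣m gcd) (GCD.gcd∣n gcd) eq
  ... | Bézout.result g gcd (Bézout.-+ x y eq) =
    Pair-cyclic-swap (gcd-generates b a y x (GCD.gcd∣n gcd) (GCD.gcd∣m gcd) eq)

-- x * m ≡ -1 (mod n) makes (n - 1) * x an inverse of m
x*m≡-1⇒invertible : ∀ {m} n {x y} .{{_ : NonZero m}} → suc (x * m) ≡ y * n →
                    ∃₂ λ p q → p * m ≡ suc (q * n)
x*m≡-1⇒invertible zero {y = y} e with () ← trans e (*-zeroʳ y)
x*m≡-1⇒invertible {suc k} (suc zero) e =
  1 , k , trans (*-identityˡ (suc k)) (cong suc (sym (*-identityʳ k)))
x*m≡-1⇒invertible {m} (suc (suc M)) {x} {suc y} e = suc M * x , M + y * suc M ,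
  +-cancelˡ-≡ (suc M) _ _ (begin
    suc M + suc M * x * m                          ≡⟨ rearrangeˡ M x m ⟩
    suc M * suc (x * m)                            ≡⟨ cong (suc M *_) e ⟩
    suc M * (suc y * suc (suc M))                  ≡⟨ rearrangeʳ M y ⟩
    suc M + suc ((M + y * suc M) * suc (suc M))    ∎)
  where
  open ≡-Reasoning
  rearrangeˡ : ∀ M x m → suc M + suc M * x * m ≡ suc M * suc (x * m)
  rearrangeˡ = solve-∀
  rearrangeʳ : ∀ M y → suc M * (suc y * suc (suc M)) ≡ suc M + suc ((M + y * suc M) * suc (suc M))
  rearrangeʳ = solve-∀

coprime⇒invertible : ∀ {m n} .{{_ : NonZero m}} → Coprime m n → ∃₂ λ p q → p * m ≡ suc (q * n)
coprime⇒invertible {n = n} coprime with coprime-Bézout coprime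
... | Bézout.+- x y eq = x , y , sym eq
... | Bézout.-+ x y eq = x*m≡-1⇒invertible n {x} {y} eq

module CoprimeProduct (G : FiniteGroup) (n : ℕ) .{{_ : NonZero n}}
                      (coprime : Coprime n (FiniteGroup.order G)) where
  open FiniteGroupProperties G
  module ℤ = ℤₙ n
  open ≡-Reasoning

  P : GroupOps
  P = ops ×G ℤ[ n ]

  power-kills-ℤₙ : ∀ g t → ∃ λ k → power P (g , t) k ≡ (g , ℤ.ε)
  power-kills-ℤₙ g t with coprime⇒invertible coprime
  ... | p , q , p*n≡1+q*order = p * n ,
    trans (power-×G ops ℤ[ n ] g t (p * n)) (cong₂ _,_ fixes-g (ℤ.^-*-modulus t p))
    where
    fixes-g : g ^ (p * n) ≡ g
    fixes-g = begin
      g ^ (p * n)             ≡⟨ cong (g ^_) p*n≡1+q*order ⟩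
      g ∙ g ^ (q * order)     ≡⟨ cong (g ∙_) (^-*-ε (^-order≡ε g) q) ⟩
      g ∙ ε                   ≡⟨ identityʳ g ⟩
      g                       ∎

  module _ {S : Fin order × Fin n → Set} where

    Gen-fst : ∀ {g t} → Gen P S (g , t) → Gen P S (g , ℤ.ε)
    Gen-fst {g} {t} gt∈ =
      let k , [g,t]ᵏ≡[g,ε] = power-kills-ℤₙ g t in subst (Gen P S) [g,t]ᵏ≡[g,ε] (Gen-power gt∈ k)

    Gen-snd : ∀ {g t} → Gen P S (g , t) → Gen P S (ε , t)
    Gen-snd {g} {t} gt∈ = subst (Gen P S)
      (cong₂ _,_ (inverseˡ g) (trans (cong (ℤ._∙ t) ℤ.ε⁻¹≡ε) (ℤ.identityˡ t)))
      (mul (inv (Gen-fst gt∈)) gt∈)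

    Gen-pair : ∀ {g t} → Gen P S (g , ℤ.ε) → Gen P S (ε , t) → Gen P S (g , t)
    Gen-pair {g} {t} g∈ t∈ = subst (Gen P S) (cong₂ _,_ (identityʳ g) (ℤ.identityˡ t)) (mul g∈ t∈)

  inj₁-hom : IsHomomorphism ops P (_, ℤ.ε)
  inj₁-hom = inj₁-homomorphism ops ℤ[ n ] (ℤ.identityˡ ℤ.ε) ℤ.ε⁻¹≡ε

  inj₂-hom : IsHomomorphism ℤ[ n ] P (ε ,_)
  inj₂-hom = inj₂-homomorphism ops ℤ[ n ] (identityˡ ε) ε⁻¹≈ε

  Pair-cyclic-proj₁ : ∀ {x a y b} → CyclicGen P (Pair P (x , a) (y , b)) → CyclicGen ops (Pair ops x y)
  Pair-cyclic-proj₁ (w , w∈ , ⟨xa,yb⟩⊆⟨w⟩) =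
    cyclic (Gen-map (proj₁-homomorphism ops ℤ[ n ])
                    (λ { (inj₁ refl) → gen (inj₁ refl) ; (inj₂ refl) → gen (inj₂ refl) }) w∈)
           (Pair⊆Gen (proj₁-∈ (⟨xa,yb⟩⊆⟨w⟩ _ (gen (inj₁ refl))))
                     (proj₁-∈ (⟨xa,yb⟩⊆⟨w⟩ _ (gen (inj₂ refl)))))
    where
    proj₁-∈ : ∀ {u} → Gen P (_≡ w) u → Gen ops (_≡ proj₁ w) (proj₁ u)
    proj₁-∈ = Gen-map (proj₁-homomorphism ops ℤ[ n ]) (λ { refl → gen refl })

  Pair-cyclic-lift : ∀ {x a y b} → CyclicGen ops (Pair ops x y) → CyclicGen P (Pair P (x , a) (y , b))
  Pair-cyclic-lift {x} {a} {y} {b} (z , z∈ , ⟨x,y⟩⊆⟨z⟩) with ℤ.Pair-cyclic a b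
  ... | c , c∈ , ⟨a,b⟩⊆⟨c⟩ =
    cyclic (Gen-pair (Gen-map inj₁-hom (λ { (inj₁ refl) → Gen-fst xa∈ ; (inj₂ refl) → Gen-fst yb∈ }) z∈)
                     (Gen-map inj₂-hom (λ { (inj₁ refl) → Gen-snd xa∈ ; (inj₂ refl) → Gen-snd yb∈ }) c∈))
           (Pair⊆Gen (∈⟨zc⟩ (⟨x,y⟩⊆⟨z⟩ x (gen (inj₁ refl))) (⟨a,b⟩⊆⟨c⟩ a (gen (inj₁ refl))))
                     (∈⟨zc⟩ (⟨x,y⟩⊆⟨z⟩ y (gen (inj₂ refl))) (⟨a,b⟩⊆⟨c⟩ b (gen (inj₂ refl)))))
    where
    xa∈ : Gen P (Pair P (x , a) (y , b)) (x , a)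
    xa∈ = gen (inj₁ refl)
    yb∈ : Gen P (Pair P (x , a) (y , b)) (y , b)
    yb∈ = gen (inj₂ refl)

    ∈⟨zc⟩ : ∀ {u v} → Gen ops (_≡ z) u → Gen ℤ[ n ] (_≡ c) v → Gen P (_≡ (z , c)) (u , v)
    ∈⟨zc⟩ u∈ v∈ = Gen-pair (Gen-map inj₁-hom (λ { refl → Gen-fst (gen refl) }) u∈)
                           (Gen-map inj₂-hom (λ { refl → Gen-snd (gen refl) }) v∈)

  Pair-cyclic⇔ : ∀ u v → CyclicGen P (Pair P u v) ⇔ CyclicGen ops (Pair ops (proj₁ u) (proj₁ v))
  Pair-cyclic⇔ (x , a) (y , b) = mk⇔ Pair-cyclic-proj₁ Pair-cyclic-lift

-- Clique blow-ups of graphs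

-- EnhancedPowerGraph G is relationGraph (λ x y → CyclicGen G (Pair G x y)) by definition
relationGraph : {A : Set} → (A → A → Set) → Graph
relationGraph {A} C = record { V = A ; Adj = λ x y → ¬ x ≡ y × C x y }

module _ {Γ Δ : Graph} where
  open Graph

  InducedP4-transport : (p : InducedP4 Γ) (g : Fin 4 → V Δ) → Injective _≡_ _≡_ g →
    (∀ i j → Adj Γ (proj₁ p i) (proj₁ p j) ⇔ Adj Δ (g i) (g j)) → InducedP4 Δ
  InducedP4-transport (f , _ , a01 , a12 , a23 , ¬a02 , ¬a03 , ¬a13) g g-injective f~g =
    g , g-injective , to (f~g v0 v1) a01 , to (f~g v1 v2) a12 , to (f~g v2 v3) a23 ,
    ¬a02 ∘ from (f~g v0 v2) , ¬a03 ∘ from (f~g v0 v3) , ¬a13 ∘ from (f~g v1 v3)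

  InducedCycle-transport : ∀ {m} (c : InducedCycle Γ m) (g : Fin m → V Δ) → Injective _≡_ _≡_ g →
    (∀ i j → Adj Γ (proj₁ c i) (proj₁ c j) ⇔ Adj Δ (g i) (g j)) → InducedCycle Δ m
  InducedCycle-transport (f , _ , cycle) g g-injective f~g =
    g , g-injective , λ i j → proj₁ (cycle i j) ∘ from (f~g i j) , to (f~g i j) ∘ proj₂ (cycle i j)

-- CycNext, stated on the underlying naturals so that its equations can be matched on
CyclicSucc : ℕ → ℕ → ℕ → Set
CyclicSucc m a b = (1 + a ≡ b) ⊎ (1 + a ≡ m × b ≡ 0)

CyclicSucc-predecessor : ∀ {m} (i : Fin m) → ∃ λ (k : Fin m) → CyclicSucc m (toℕ k) (toℕ i)
CyclicSucc-predecessor {suc m} zero    = fromℕ m , inj₂ (cong suc (toℕ-fromℕ m) , refl)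
CyclicSucc-predecessor {suc m} (suc i) = inject₁ i , inj₁ (cong suc (toℕ-inject₁ i))

CyclicSucc-asym : ∀ {m i j} → 3 ≤ m → CyclicSucc m i j → ¬ CyclicSucc m j i
CyclicSucc-asym {i = i} _      (inj₁ refl)         (inj₁ e)            = m≢1+n+m i (sym e)
CyclicSucc-asym (s≤s (s≤s ())) (inj₁ refl)         (inj₂ (refl , refl))
CyclicSucc-asym (s≤s (s≤s ())) (inj₂ (refl , refl)) (inj₁ refl)

CyclicSucc-no-chord : ∀ {m i j k} → 4 ≤ m → CyclicSucc m i j → CyclicSucc m k i →
                      ¬ (CyclicSucc m j k ⊎ CyclicSucc m k j)
CyclicSucc-no-chord {k = k} _ (inj₁ refl) (inj₁ refl) (inj₁ (inj₁ e)) = m≢1+n+m k (sym e)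
CyclicSucc-no-chord (s≤s (s≤s (s≤s ()))) (inj₁ refl) (inj₁ refl) (inj₁ (inj₂ (refl , refl)))
CyclicSucc-no-chord _ (inj₁ refl) (inj₁ refl) (inj₂ (inj₂ (_ , ())))
CyclicSucc-no-chord (s≤s (s≤s (s≤s ()))) (inj₁ refl) (inj₂ (refl , refl)) (inj₁ (inj₁ refl))
CyclicSucc-no-chord _ (inj₁ refl) (inj₂ (refl , refl)) (inj₂ (inj₂ (_ , ())))
CyclicSucc-no-chord (s≤s (s≤s (s≤s ()))) (inj₂ (refl , refl)) (inj₁ refl) (inj₁ (inj₁ refl))
CyclicSucc-no-chord _ (inj₂ (refl , refl)) (inj₁ refl) (inj₂ (inj₂ (e , _))) = 1+n≢n (sym (cong pred e))

-- relationGraph D is relationGraph C with every vertex a replaced by a clique on π ⁻¹ a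
module CliqueBlowup {A B : Set} (C : A → A → Set) (D : B → B → Set)
                    (π : B → A) (σ : A → B) (π∘σ≡id : ∀ a → π (σ a) ≡ a)
                    (D⇔C : ∀ p q → D p q ⇔ C (π p) (π q)) (C-refl : ∀ a → C a a) where
  Γ Δ : Graph
  Γ = relationGraph C
  Δ = relationGraph D

  open Graph Δ using (Adj)
  private
    AdjΓ : A → A → Set
    AdjΓ = Graph.Adj Γ

  fibre-adjacent : ∀ {p q} → π p ≡ π q → ¬ p ≡ q → Adj p q
  fibre-adjacent {p} {q} e p≢q = p≢q , from (D⇔C p q) (subst (C (π p)) e (C-refl (π p)))

  fibre-twinˡ : ∀ {p q r} → π p ≡ π q → Adj p r → ¬ q ≡ r → Adj q r
  fibre-twinˡ {p} {q} {r} e (_ , d) q≢r =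
    q≢r , from (D⇔C q r) (subst (λ a → C a (π r)) e (to (D⇔C p r) d))

  fibre-twinʳ : ∀ {p q r} → π p ≡ π q → Adj r p → ¬ r ≡ q → Adj r q
  fibre-twinʳ {p} {q} {r} e (_ , d) r≢q =
    r≢q , from (D⇔C r q) (subst (C (π r)) e (to (D⇔C r p) d))

  Adj⇔Adj-π : ∀ {p q} → (π p ≡ π q → p ≡ q) → Adj p q ⇔ AdjΓ (π p) (π q)
  Adj⇔Adj-π {p} {q} π-reflects = mk⇔
    (λ (p≢q , d) → p≢q ∘ π-reflects , to (D⇔C p q) d)
    (λ (πp≢πq , c) → πp≢πq ∘ cong π , from (D⇔C p q) c)

  σ-injective : Injective _≡_ _≡_ σ
  σ-injective {a} {b} e = trans (sym (π∘σ≡id a)) (trans (cong π e) (π∘σ≡id b))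

  Adj⇔Adj-σ : ∀ {a b} → AdjΓ a b ⇔ Adj (σ a) (σ b)
  Adj⇔Adj-σ {a} {b} = mk⇔
    (λ (a≢b , c) → a≢b ∘ σ-injective , from (D⇔C _ _) (subst₂ C (sym (π∘σ≡id a)) (sym (π∘σ≡id b)) c))
    (λ (σa≢σb , d) → σa≢σb ∘ cong σ , subst₂ C (π∘σ≡id a) (π∘σ≡id b) (to (D⇔C _ _) d))

  InducedP4-π-injective : (p : InducedP4 Δ) → Injective _≡_ _≡_ (π ∘ proj₁ p)
  InducedP4-π-injective (f , f-injective , a01 , a12 , a23 , ¬a02 , ¬a03 , ¬a13) = go
    where
    distinct : ∀ {i j} → ¬ i ≡ j → ¬ f i ≡ f j
    distinct i≢j = i≢j ∘ f-injective

    -- two vertices of a P₄ are non-adjacent or told apart by a neighbour of only one of them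
    go : ∀ {i j} → π (f i) ≡ π (f j) → i ≡ j
    go {zero}                 {zero}                 _ = refl
    go {suc zero}             {suc zero}             _ = refl
    go {suc (suc zero)}       {suc (suc zero)}       _ = refl
    go {suc (suc (suc zero))} {suc (suc (suc zero))} _ = refl
    go {zero} {suc zero} e = ⊥-elim (¬a02 (fibre-twinˡ (sym e) a12 (distinct λ ())))
    go {suc zero} {zero} e = ⊥-elim (¬a02 (fibre-twinˡ e a12 (distinct λ ())))
    go {zero} {suc (suc zero)} e = ⊥-elim (¬a02 (fibre-adjacent e (distinct λ ())))
    go {suc (suc zero)} {zero} e = ⊥-elim (¬a02 (fibre-adjacent (sym e) (distinct λ ())))
    go {zero} {suc (suc (suc zero))} e = ⊥-elim (¬a03 (fibre-adjacent e (distinct λ ())))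
    go {suc (suc (suc zero))} {zero} e = ⊥-elim (¬a03 (fibre-adjacent (sym e) (distinct λ ())))
    go {suc zero} {suc (suc zero)} e = ⊥-elim (¬a02 (fibre-twinʳ e a01 (distinct λ ())))
    go {suc (suc zero)} {suc zero} e = ⊥-elim (¬a02 (fibre-twinʳ (sym e) a01 (distinct λ ())))
    go {suc zero} {suc (suc (suc zero))} e = ⊥-elim (¬a13 (fibre-adjacent e (distinct λ ())))
    go {suc (suc (suc zero))} {suc zero} e = ⊥-elim (¬a13 (fibre-adjacent (sym e) (distinct λ ())))
    go {suc (suc zero)} {suc (suc (suc zero))} e = ⊥-elim (¬a13 (fibre-twinʳ e a12 (distinct λ ())))
    go {suc (suc (suc zero))} {suc (suc zero)} e = ⊥-elim (¬a13 (fibre-twinʳ (sym e) a12 (distinct λ ())))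

  module _ {m} (4≤m : 4 ≤ m) (c : InducedCycle Δ m) where
    private
      f : Fin m → B
      f = proj₁ c
      f-injective : Injective _≡_ _≡_ f
      f-injective = proj₁ (proj₂ c)
      edges : ∀ i j → (Adj (f i) (f j) → CycAdj Δ i j) × (CycAdj Δ i j → Adj (f i) (f j))
      edges = proj₂ (proj₂ c)

    -- a twin j of i following i on the cycle would also be adjacent to the predecessor k of i
    no-successor-twin : ∀ {i j} → π (f i) ≡ π (f j) → ¬ CycNext Δ i j
    no-successor-twin {i} {j} e i→j with CyclicSucc-predecessor i
    ... | k , k→i with j ≟ᶠ k
    ... | yes refl = CyclicSucc-asym (≤-trans (n≤1+n 3) 4≤m) i→j k→i
    ... | no j≢k = CyclicSucc-no-chord 4≤m i→j k→i
      (proj₁ (edges j k) (fibre-twinˡ e (proj₂ (edges i k) (inj₂ k→i)) (j≢k ∘ f-injective)))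

    InducedCycle-π-injective : Injective _≡_ _≡_ (π ∘ f)
    InducedCycle-π-injective {i} {j} e with i ≟ᶠ j
    ... | yes i≡j = i≡j
    ... | no i≢j with proj₁ (edges i j) (fibre-adjacent e (i≢j ∘ f-injective))
    ... | inj₁ i→j = ⊥-elim (no-successor-twin e i→j)
    ... | inj₂ j→i = ⊥-elim (no-successor-twin (sym e) j→i)

  cograph⇔ : IsCograph Δ ⇔ IsCograph Γ
  cograph⇔ = mk⇔
    (λ cographΔ p → cographΔ (InducedP4-transport {Γ} {Δ} p (σ ∘ proj₁ p)
      (proj₁ (proj₂ p) ∘ σ-injective) (λ _ _ → Adj⇔Adj-σ)))
    (λ cographΓ p → cographΓ (InducedP4-transport {Δ} {Γ} p (π ∘ proj₁ p) (InducedP4-π-injective p)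
      (λ _ _ → Adj⇔Adj-π (cong (proj₁ p) ∘ InducedP4-π-injective p))))

  chordal⇔ : IsChordal Δ ⇔ IsChordal Γ
  chordal⇔ = mk⇔
    (λ chordalΔ m 4≤m c → chordalΔ m 4≤m (InducedCycle-transport {Γ} {Δ} c (σ ∘ proj₁ c)
      (proj₁ (proj₂ c) ∘ σ-injective) (λ _ _ → Adj⇔Adj-σ)))
    (λ chordalΓ m 4≤m c → chordalΓ m 4≤m (InducedCycle-transport {Δ} {Γ} c (π ∘ proj₁ c)
      (InducedCycle-π-injective 4≤m c)
      (λ _ _ → Adj⇔Adj-π (cong (proj₁ c) ∘ InducedCycle-π-injective 4≤m c))))

corollary4p15 : (G : FiniteGroup) (n : ℕ) .{{_ : NonZero n}} →
    Coprime n (FiniteGroup.order G) →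
    (IsCograph (EnhancedPowerGraph (FiniteGroup.ops G ×G ℤ[ n ]))
       ⇔ IsCograph (EnhancedPowerGraph (FiniteGroup.ops G)))
    × (IsChordal (EnhancedPowerGraph (FiniteGroup.ops G ×G ℤ[ n ]))
       ⇔ IsChordal (EnhancedPowerGraph (FiniteGroup.ops G)))
corollary4p15 G n coprime = cograph⇔ , chordal⇔
  where
  open FiniteGroup G using (ops)
  open CoprimeProduct G n coprime using (P; Pair-cyclic⇔)
  open CliqueBlowup (λ x y → CyclicGen ops (Pair ops x y)) (λ u v → CyclicGen P (Pair P u v))
                    proj₁ (_, GroupOps.ε ℤ[ n ]) (λ _ → refl) Pair-cyclic⇔ Pair-self-cyclic
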